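{- Let $G=(V,E)$ be a directed graph with $V=\{v_1,\dots,v_n\}$, without self-loops and in which every vertex has at least one outgoing edge. Construct the MDP $P$ whose vertex set consists of a start vertex $s$ and four copies $V^1,V^2,V^3,V^4$ of $V$, with $v_{ji}\in V^j$ the copy of $v_i$; edges: $(s,v_{1i})$ for all $i$, and for $1\le j\le 3$, $(v_{ji},v_{(j+1)l})$ iff $(v_i,v_l)\in E$; all vertices are random vertices (there are no player-1 vertices). Let the target sets be $T_i=(V^1\setminus\{v_{1i}\})\cup(V^4\setminus\{v_{4i}\})$ for $i=1,\dots,n$. Then $G$ contains a triangle (vertices $x,y,z$ with $(x,y),(y,z),(z,x)\in E$) if and only if player 1 does not have an almost-sure winning policy from $s$ for the coverage objective with targets $T_1,\dots,T_n$.
   Context: In an MDP, vertices are partitioned into player-1 vertices and random vertices; at a random vertex the successor is chosen according to a probability distribution whose support is the set of out-neighbours, and at player-1 vertices by a player-1 policy. A policy $\sigma$ and start vertex $s$ induce a probability measure $\Pr_s^\sigma$ on plays; $\sigma$ is almost-sure winning from $s$ for objective $\phi$ if $\Pr_s^\sigma(\phi)=1$. $\mathrm{Reach}(T)$ is the set of plays visiting $T$. Player 1 has an almost-sure winning policy from $s$ for the coverage objective with targets $T_1,\dots,T_n$ if for every $i$ there is a policy (possibly depending on $i$) almost-sure winning from $s$ for $\mathrm{Reach}(T_i)$.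
   Formalization: The transition probabilities at the random vertices of P are rational numbers. -}

module Defs where

open import Data.Nat using (ℕ)
open import Data.Fin using (Fin; zero; suc; _≟_)
open import Data.Bool using (Bool; true; false; not; _∨_; if_then_else_)
open import Data.List using (List; _∷_; map; concatMap; foldr; allFin)
open import Data.Rational using (ℚ; 0ℚ; 1ℚ; _+_; _*_; _<_)
open import Data.Product using (_×_; ∃; Σ)
open import Relation.Nullary.Decidable using (⌊_⌋)
open import Relation.Binary.PropositionalEquality using (_≡_)

Graph : ℕ → Set
Graph n = Fin n → Fin n → Bool

Triangle : ∀ {n} → Graph n → Set
Triangle {n} E = Σ (Fin n) λ x → Σ (Fin n) λ y → Σ (Fin n) λ z →
  (E x y ≡ true) × (E y z ≡ true) × (E z x ≡ true)

-- Vertices of the MDP P: start vertex s and four copies of V.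
-- cp j i is v_{(j+1) i}; layer index zero = V^1, ..., 3 = V^4.
data PV (n : ℕ) : Set where
  start : PV n
  cp    : Fin 4 → Fin n → PV n

PEdge : ∀ {n} → Graph n → PV n → PV n → Bool
PEdge E start (cp zero i) = true
PEdge E (cp zero i) (cp (suc zero) l) = E i l
PEdge E (cp (suc zero) i) (cp (suc (suc zero)) l) = E i l
PEdge E (cp (suc (suc zero)) i) (cp (suc (suc (suc zero))) l) = E i l
PEdge E _ _ = false

allPV : (n : ℕ) → List (PV n)
allPV n = start ∷ concatMap (λ j → map (cp j) (allFin n)) (allFin 4)

sumℚ : List ℚ → ℚ
sumℚ = foldr _+_ 0ℚ

ΣPV : ∀ {n} → (PV n → ℚ) → ℚ
ΣPV {n} f = sumℚ (map f (allPV n))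

-- All vertices are random vertices: δ u v is the probability of moving from u to v.
record IsTransition {n : ℕ} (E : Graph n) (δ : PV n → PV n → ℚ) : Set where
  field
    support-pos  : ∀ u v → PEdge E u v ≡ true → 0ℚ < δ u v
    support-zero : ∀ u v → PEdge E u v ≡ false → δ u v ≡ 0ℚ
    stochastic   : ∀ u → (∃ λ v → PEdge E u v ≡ true) → ΣPV (δ u) ≡ 1ℚ

Target : ∀ {n} → Fin n → PV n → Bool
Target k (cp zero i) = not ⌊ i ≟ k ⌋
Target k (cp (suc (suc (suc zero))) i) = not ⌊ i ≟ k ⌋
Target k _ = false

-- Every play from s is s a b c d with d ∈ V^4, and V^4 vertices
-- have no outgoing edges, so the measure is the discrete one on these paths
-- (paths that are not edge-paths get weight 0).
PrReach : ∀ {n} → (PV n → PV n → ℚ) → (PV n → Bool) → ℚ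
PrReach δ T =
  ΣPV λ a → ΣPV λ b → ΣPV λ c → ΣPV λ d →
    if (T start ∨ T a ∨ T b ∨ T c ∨ T d)
      then δ start a * δ a b * δ b c * δ c d
      else 0ℚ

-- P has no player-1 vertices, so there is exactly one (trivial) policy and
-- "some policy is almost-sure winning for Reach(T_k)" is Pr_s(Reach T_k) = 1.
AlmostSureWinningReach : ∀ {n} → (PV n → PV n → ℚ) → (PV n → Bool) → Set
AlmostSureWinningReach δ T = PrReach δ T ≡ 1ℚ

AlmostSureCoverage : ∀ {n} → Graph n → (PV n → PV n → ℚ) → Set
AlmostSureCoverage {n} E δ = (k : Fin n) → AlmostSureWinningReach δ (Target k)

-- Every play from s is a path s a b c d of length four, so Pr(Reach T_k) = 1 exactly when
-- the paths missing T_k carry no probability mass. A path of positive mass follows edges of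
-- P, hence is s v_{1i} v_{2j} v_{3l} v_{4m} with i → j → l → m in G, and it misses T_k
-- exactly when i = k = m, i.e. when k → j → l → k is a triangle of G.
module Submission where

open import Defs
open import Data.Nat using (ℕ; zero; suc)
open import Data.Fin using (Fin; zero; suc; inject₁)
import Data.Fin as Fin
open import Data.Fin.Properties using (any?)
open import Data.Bool using (Bool; true; false; _∨_; if_then_else_)
import Data.Bool as Bool
open import Data.List using ([]; _∷_; map; allFin)
open import Data.List.Relation.Unary.Any using (here; there)
open import Data.List.Membership.Propositional using (_∈_; lose)
open import Data.List.Membership.Propositional.Properties using (∈-map⁺; ∈-concatMap⁺; ∈-allFin)
open import Data.Rational using (ℚ; 0ℚ; 1ℚ; _+_; _*_; _<_; _≤_; positive; nonNegative)
open import Data.Rational.Properties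
open import Algebra.Bundles using (CommutativeMonoid)
open import Algebra.Properties.CommutativeSemigroup
  (CommutativeMonoid.commutativeSemigroup +-0-commutativeMonoid) using (interchange)
open import Algebra.Properties.Group +-0-group using (∙-cancelˡ)
open import Data.Product using (∃; _,_; _×_)
open import Relation.Nullary using (¬_; yes; no; Dec; contradiction)
open import Relation.Nullary.Decidable using (_×-dec_; decidable-stable)
open import Relation.Binary.PropositionalEquality
open import Function.Bundles using (_⇔_; mk⇔; Equivalence)

module _ {A : Set} where

  sumℚ-map-cong : ∀ {f g : A → ℚ} xs → (∀ x → f x ≡ g x) →
    sumℚ (map f xs) ≡ sumℚ (map g xs)
  sumℚ-map-cong []       f≡g = refl
  sumℚ-map-cong (x ∷ xs) f≡g = cong₂ _+_ (f≡g x) (sumℚ-map-cong xs f≡g)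

  sumℚ-map-+ : ∀ (f g : A → ℚ) xs →
    sumℚ (map f xs) + sumℚ (map g xs) ≡ sumℚ (map (λ x → f x + g x) xs)
  sumℚ-map-+ f g []       = +-identityʳ 0ℚ
  sumℚ-map-+ f g (x ∷ xs) =
    trans (interchange (f x) _ (g x) _) (cong (f x + g x +_) (sumℚ-map-+ f g xs))

  *-distribˡ-sumℚ-map : ∀ p (f : A → ℚ) xs →
    p * sumℚ (map f xs) ≡ sumℚ (map (λ x → p * f x) xs)
  *-distribˡ-sumℚ-map p f []       = *-zeroʳ p
  *-distribˡ-sumℚ-map p f (x ∷ xs) =
    trans (*-distribˡ-+ p (f x) _) (cong (p * f x +_) (*-distribˡ-sumℚ-map p f xs))

  sumℚ-map-zero : ∀ {f : A → ℚ} xs → (∀ x → f x ≡ 0ℚ) → sumℚ (map f xs) ≡ 0ℚ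
  sumℚ-map-zero []       f≡0 = refl
  sumℚ-map-zero (x ∷ xs) f≡0 =
    trans (cong₂ _+_ (f≡0 x) (sumℚ-map-zero xs f≡0)) (+-identityʳ 0ℚ)

  sumℚ-map-nonNeg : ∀ {f : A → ℚ} xs → (∀ x → 0ℚ ≤ f x) → 0ℚ ≤ sumℚ (map f xs)
  sumℚ-map-nonNeg []       f≥0 = ≤-refl
  sumℚ-map-nonNeg {f} (x ∷ xs) f≥0 = subst (_≤ f x + sumℚ (map f xs)) (+-identityʳ 0ℚ)
    (+-mono-≤ (f≥0 x) (sumℚ-map-nonNeg xs f≥0))

  sumℚ-map-pos : ∀ {f : A → ℚ} {y} xs → (∀ x → 0ℚ ≤ f x) → y ∈ xs → 0ℚ < f y →
    0ℚ < sumℚ (map f xs)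
  sumℚ-map-pos {f} (x ∷ xs) f≥0 (here refl) fy>0 = subst (_< f x + sumℚ (map f xs))
    (+-identityʳ 0ℚ) (+-mono-<-≤ fy>0 (sumℚ-map-nonNeg xs f≥0))
  sumℚ-map-pos {f} (x ∷ xs) f≥0 (there y∈xs) fy>0 = subst (_< f x + sumℚ (map f xs))
    (+-identityʳ 0ℚ) (+-mono-≤-< (f≥0 x) (sumℚ-map-pos xs f≥0 y∈xs fy>0))

*-nonNeg : ∀ {p q} → 0ℚ ≤ p → 0ℚ ≤ q → 0ℚ ≤ p * q
*-nonNeg {p} {q} p≥0 q≥0 =
  nonNegative⁻¹ _ {{nonNeg*nonNeg⇒nonNeg p {{nonNegative p≥0}} q {{nonNegative q≥0}}}}

*-pos : ∀ {p q} → 0ℚ < p → 0ℚ < q → 0ℚ < p * q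
*-pos {p} {q} p>0 q>0 = positive⁻¹ _ {{pos*pos⇒pos p {{positive p>0}} q {{positive q>0}}}}

*≢0⇒≢0 : ∀ {p q} → p * q ≢ 0ℚ → p ≢ 0ℚ × q ≢ 0ℚ
*≢0⇒≢0 {p} {q} pq≢0 =
  (λ p≡0 → pq≢0 (trans (cong (_* q) p≡0) (*-zeroˡ q))) ,
  (λ q≡0 → pq≢0 (trans (cong (p *_) q≡0) (*-zeroʳ p)))

p+q≡r⇒p≡r⇔q≡0 : ∀ {p q r} → p + q ≡ r → p ≡ r ⇔ q ≡ 0ℚ
p+q≡r⇒p≡r⇔q≡0 {p} {q} p+q≡r = mk⇔
  (λ p≡r → ∙-cancelˡ p q 0ℚ (trans p+q≡r (trans (sym p≡r) (sym (+-identityʳ p)))))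
  (λ q≡0 → trans (sym (trans (cong (p +_) q≡0) (+-identityʳ p))) p+q≡r)

if-+-if-not : ∀ b p → (if b then p else 0ℚ) + (if b then 0ℚ else p) ≡ p
if-+-if-not true  p = +-identityʳ p
if-+-if-not false p = +-identityˡ p

Triangle? : ∀ {n} (E : Graph n) → Dec (Triangle E)
Triangle? E = any? λ x → any? λ y → any? λ z →
  (E x y Bool.≟ true) ×-dec (E y z Bool.≟ true) ×-dec (E z x Bool.≟ true)

module _ {n : ℕ} where

  ∈-allPV : (v : PV n) → v ∈ allPV n
  ∈-allPV start    = here refl
  ∈-allPV (cp j i) = there (∈-concatMap⁺ (λ j → map (cp j) (allFin n))
                                         (lose (∈-allFin j) (∈-map⁺ (cp j) (∈-allFin i))))

  ΣPV-cong : ∀ {f g : PV n → ℚ} → (∀ v → f v ≡ g v) → ΣPV f ≡ ΣPV g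
  ΣPV-cong = sumℚ-map-cong (allPV n)

  ΣPV-+ : ∀ (f g : PV n → ℚ) → ΣPV f + ΣPV g ≡ ΣPV (λ v → f v + g v)
  ΣPV-+ f g = sumℚ-map-+ f g (allPV n)

  ΣPV-zero : ∀ {f : PV n → ℚ} → (∀ v → f v ≡ 0ℚ) → ΣPV f ≡ 0ℚ
  ΣPV-zero = sumℚ-map-zero (allPV n)

  ΣPV-nonNeg : ∀ {f : PV n → ℚ} → (∀ v → 0ℚ ≤ f v) → 0ℚ ≤ ΣPV f
  ΣPV-nonNeg = sumℚ-map-nonNeg (allPV n)

  ΣPV-pos : ∀ {f : PV n → ℚ} {v} → (∀ u → 0ℚ ≤ f u) → 0ℚ < f v → 0ℚ < ΣPV f
  ΣPV-pos {v = v} f≥0 = sumℚ-map-pos (allPV n) f≥0 (∈-allPV v)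

  Σ⁴ : (PV n → PV n → PV n → PV n → ℚ) → ℚ
  Σ⁴ f = ΣPV λ a → ΣPV λ b → ΣPV λ c → ΣPV λ d → f a b c d

  Σ⁴-cong : ∀ {f g : PV n → PV n → PV n → PV n → ℚ} →
    (∀ a b c d → f a b c d ≡ g a b c d) → Σ⁴ f ≡ Σ⁴ g
  Σ⁴-cong f≡g = ΣPV-cong λ a → ΣPV-cong λ b → ΣPV-cong λ c → ΣPV-cong λ d → f≡g a b c d

  Σ⁴-+ : ∀ (f g : PV n → PV n → PV n → PV n → ℚ) →
    Σ⁴ f + Σ⁴ g ≡ Σ⁴ (λ a b c d → f a b c d + g a b c d)
  Σ⁴-+ f g =
    trans (ΣPV-+ (λ a → ΣPV λ b → ΣPV λ c → ΣPV (f a b c))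
                 (λ a → ΣPV λ b → ΣPV λ c → ΣPV (g a b c))) (ΣPV-cong λ a →
    trans (ΣPV-+ (λ b → ΣPV λ c → ΣPV (f a b c)) (λ b → ΣPV λ c → ΣPV (g a b c))) (ΣPV-cong λ b →
    trans (ΣPV-+ (λ c → ΣPV (f a b c)) (λ c → ΣPV (g a b c))) (ΣPV-cong λ c →
    ΣPV-+ (f a b c) (g a b c))))

  Σ⁴-zero : ∀ {f : PV n → PV n → PV n → PV n → ℚ} →
    (∀ a b c d → f a b c d ≡ 0ℚ) → Σ⁴ f ≡ 0ℚ
  Σ⁴-zero f≡0 = ΣPV-zero λ a → ΣPV-zero λ b → ΣPV-zero λ c → ΣPV-zero λ d → f≡0 a b c d

  Σ⁴-pos : ∀ {f : PV n → PV n → PV n → PV n → ℚ} a b c d →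
    (∀ a b c d → 0ℚ ≤ f a b c d) → 0ℚ < f a b c d → 0ℚ < Σ⁴ f
  Σ⁴-pos a b c d f≥0 f>0 =
    ΣPV-pos (λ a′ → ΣPV-nonNeg λ b′ → ΣPV-nonNeg λ c′ → ΣPV-nonNeg λ d′ → f≥0 a′ b′ c′ d′)
      (ΣPV-pos (λ b′ → ΣPV-nonNeg λ c′ → ΣPV-nonNeg λ d′ → f≥0 a b′ c′ d′)
        (ΣPV-pos (λ c′ → ΣPV-nonNeg λ d′ → f≥0 a b c′ d′)
          (ΣPV-pos (λ d′ → f≥0 a b c d′) f>0)))

  hits : (PV n → Bool) → PV n → PV n → PV n → PV n → Bool
  hits T a b c d = T start ∨ T a ∨ T b ∨ T c ∨ T d

  closedPath-misses : ∀ (x y z : Fin n) →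
    hits (Target x) (cp zero x) (cp (suc zero) y) (cp (suc (suc zero)) z)
                    (cp (suc (suc (suc zero))) x) ≡ false
  closedPath-misses x y z with x Fin.≟ x
  ... | yes _   = refl
  ... | no x≢x  = contradiction refl x≢x

module _ {n : ℕ} (δ : PV n → PV n → ℚ) where

  pathWeight : PV n → PV n → PV n → PV n → ℚ
  pathWeight a b c d = δ start a * δ a b * δ b c * δ c d

  missWeight : (PV n → Bool) → PV n → PV n → PV n → PV n → ℚ
  missWeight T a b c d = if hits T a b c d then 0ℚ else pathWeight a b c d

  missWeight≡pathWeight : ∀ T a b c d → hits T a b c d ≡ false →
    missWeight T a b c d ≡ pathWeight a b c d
  missWeight≡pathWeight T a b c d miss rewrite miss = refl

  PrMiss : (PV n → Bool) → ℚ
  PrMiss T = Σ⁴ (missWeight T)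

  PrReach+PrMiss≡Σ⁴pathWeight : ∀ T → PrReach δ T + PrMiss T ≡ Σ⁴ pathWeight
  PrReach+PrMiss≡Σ⁴pathWeight T =
    trans (Σ⁴-+ (λ a b c d → if hits T a b c d then pathWeight a b c d else 0ℚ) (missWeight T))
          (Σ⁴-cong λ a b c d → if-+-if-not (hits T a b c d) (pathWeight a b c d))

  mass : ℕ → PV n → ℚ
  mass zero    u = 1ℚ
  mass (suc r) u = ΣPV λ v → δ u v * mass r v

  pathSum : ℕ → ℚ → PV n → ℚ
  pathSum zero    p u = p
  pathSum (suc r) p u = ΣPV λ v → pathSum r (p * δ u v) v

  pathSum≡*mass : ∀ r p u → pathSum r p u ≡ p * mass r u
  pathSum≡*mass zero    p u = sym (*-identityʳ p)
  pathSum≡*mass (suc r) p u = begin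
    ΣPV (λ v → pathSum r (p * δ u v) v)  ≡⟨ ΣPV-cong (λ v → pathSum≡*mass r (p * δ u v) v) ⟩
    ΣPV (λ v → p * δ u v * mass r v)    ≡⟨ ΣPV-cong (λ v → *-assoc p (δ u v) (mass r v)) ⟩
    ΣPV (λ v → p * (δ u v * mass r v))  ≡⟨ *-distribˡ-sumℚ-map p _ (allPV n) ⟨
    p * mass (suc r) u                  ∎
    where open ≡-Reasoning

  Σ⁴pathWeight≡mass : Σ⁴ pathWeight ≡ mass 4 start
  Σ⁴pathWeight≡mass = ΣPV-cong λ a → pathSum≡*mass 3 (δ start a) a

module _ {n : ℕ} (E : Graph n) where

  PEdge-start : ∀ v → PEdge E start v ≡ true → ∃ λ i → v ≡ cp zero i
  PEdge-start (cp zero i)    _ = i , refl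
  PEdge-start start          ()
  PEdge-start (cp (suc _) _) ()

  PEdge-layer : ∀ (j : Fin 3) i l → PEdge E (cp (inject₁ j) i) (cp (suc j) l) ≡ E i l
  PEdge-layer zero             i l = refl
  PEdge-layer (suc zero)       i l = refl
  PEdge-layer (suc (suc zero)) i l = refl

  PEdge-layer⁻¹ : ∀ (j : Fin 3) i v → PEdge E (cp (inject₁ j) i) v ≡ true →
    ∃ λ l → v ≡ cp (suc j) l × E i l ≡ true
  PEdge-layer⁻¹ zero             i (cp (suc zero) l)                   e = l , refl , e
  PEdge-layer⁻¹ (suc zero)       i (cp (suc (suc zero)) l)             e = l , refl , e
  PEdge-layer⁻¹ (suc (suc zero)) i (cp (suc (suc (suc zero))) l)       e = l , refl , e
  PEdge-layer⁻¹ zero             i start                               ()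
  PEdge-layer⁻¹ zero             i (cp zero _)                         ()
  PEdge-layer⁻¹ zero             i (cp (suc (suc _)) _)                ()
  PEdge-layer⁻¹ (suc zero)       i start                               ()
  PEdge-layer⁻¹ (suc zero)       i (cp zero _)                         ()
  PEdge-layer⁻¹ (suc zero)       i (cp (suc zero) _)                   ()
  PEdge-layer⁻¹ (suc zero)       i (cp (suc (suc (suc _))) _)          ()
  PEdge-layer⁻¹ (suc (suc zero)) i start                               ()
  PEdge-layer⁻¹ (suc (suc zero)) i (cp zero _)                         ()
  PEdge-layer⁻¹ (suc (suc zero)) i (cp (suc zero) _)                   ()
  PEdge-layer⁻¹ (suc (suc zero)) i (cp (suc (suc zero)) _)             ()

  missed-edgePath⇒Triangle : ∀ k a b c d →
    PEdge E start a ≡ true → PEdge E a b ≡ true → PEdge E b c ≡ true → PEdge E c d ≡ true →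
    hits (Target k) a b c d ≡ false → Triangle E
  missed-edgePath⇒Triangle k a b c d eₛ e₁ e₂ e₃ miss
    with i , refl       ← PEdge-start a eₛ
    with j , refl , eᵢⱼ ← PEdge-layer⁻¹ zero i b e₁
    with l , refl , eⱼₗ ← PEdge-layer⁻¹ (suc zero) j c e₂
    with m , refl , eₗₘ ← PEdge-layer⁻¹ (suc (suc zero)) l d e₃
    with i Fin.≟ k | m Fin.≟ k
  ... | yes refl | yes refl = i , j , l , eᵢⱼ , eⱼₗ , eₗₘ
  ... | no _     | _        with () ← miss
  ... | yes refl | no _     with () ← miss

module _ {n : ℕ} {E : Graph n} {δ : PV n → PV n → ℚ} (tr : IsTransition E δ) where
  open IsTransition tr

  δ-nonNeg : ∀ u v → 0ℚ ≤ δ u v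
  δ-nonNeg u v with PEdge E u v in e
  ... | true  = <⇒≤ (support-pos u v e)
  ... | false = ≤-reflexive (sym (support-zero u v e))

  δ≢0⇒PEdge : ∀ {u v} → δ u v ≢ 0ℚ → PEdge E u v ≡ true
  δ≢0⇒PEdge {u} {v} δ≢0 with PEdge E u v in e
  ... | true  = refl
  ... | false = contradiction (support-zero u v e) δ≢0

  pathWeight≢0⇒edgePath : ∀ {a b c d} → pathWeight δ a b c d ≢ 0ℚ →
    PEdge E start a ≡ true × PEdge E a b ≡ true × PEdge E b c ≡ true × PEdge E c d ≡ true
  pathWeight≢0⇒edgePath w≢0 =
    let w₃≢0 , δcd≢0 = *≢0⇒≢0 w≢0
        w₂≢0 , δbc≢0 = *≢0⇒≢0 w₃≢0
        δsa≢0 , δab≢0 = *≢0⇒≢0 w₂≢0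
    in δ≢0⇒PEdge δsa≢0 , δ≢0⇒PEdge δab≢0 , δ≢0⇒PEdge δbc≢0 , δ≢0⇒PEdge δcd≢0

  mass-suc≡1 : ∀ r u → (∃ λ v → PEdge E u v ≡ true) →
    (∀ v → PEdge E u v ≡ true → mass δ r v ≡ 1ℚ) → mass δ (suc r) u ≡ 1ℚ
  mass-suc≡1 r u has-succ succ≡1 = trans (ΣPV-cong term≡δ) (stochastic u has-succ)
    where
    term≡δ : ∀ v → δ u v * mass δ r v ≡ δ u v
    term≡δ v with PEdge E u v in e
    ... | true  = trans (cong (δ u v *_) (succ≡1 v e)) (*-identityʳ (δ u v))
    ... | false = trans (cong (_* mass δ r v) (support-zero u v e))
                        (trans (*-zeroˡ (mass δ r v)) (sym (support-zero u v e)))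

  module _ (out : ∀ i → ∃ λ l → E i l ≡ true) where

    mass-layer : ∀ (j : Fin 3) r → (∀ l → mass δ r (cp (suc j) l) ≡ 1ℚ) →
      ∀ i → mass δ (suc r) (cp (inject₁ j) i) ≡ 1ℚ
    mass-layer j r next≡1 i =
      let l , eᵢₗ = out i
      in mass-suc≡1 r _ (cp (suc j) l , trans (PEdge-layer E j i l) eᵢₗ) λ v e →
           let l′ , v≡ , _ = PEdge-layer⁻¹ E j i v e
           in trans (cong (mass δ r) v≡) (next≡1 l′)

    mass-start≡1 : Fin n → mass δ 4 start ≡ 1ℚ
    mass-start≡1 k = mass-suc≡1 3 start (cp zero k , refl) λ v e →
      let i , v≡ = PEdge-start E v e
      in trans (cong (mass δ 3) v≡) (mass₁ i)
      where
      mass₃ : ∀ l → mass δ 1 (cp (suc (suc zero)) l) ≡ 1ℚ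
      mass₃ = mass-layer (suc (suc zero)) 0 λ _ → refl
      mass₂ : ∀ j → mass δ 2 (cp (suc zero) j) ≡ 1ℚ
      mass₂ = mass-layer (suc zero) 1 mass₃
      mass₁ : ∀ i → mass δ 3 (cp zero i) ≡ 1ℚ
      mass₁ = mass-layer zero 2 mass₂

    PrReach≡1⇔PrMiss≡0 : Fin n → ∀ T → PrReach δ T ≡ 1ℚ ⇔ PrMiss δ T ≡ 0ℚ
    PrReach≡1⇔PrMiss≡0 k T = p+q≡r⇒p≡r⇔q≡0 (begin
      PrReach δ T + PrMiss δ T  ≡⟨ PrReach+PrMiss≡Σ⁴pathWeight δ T ⟩
      Σ⁴ (pathWeight δ)         ≡⟨ Σ⁴pathWeight≡mass δ ⟩
      mass δ 4 start            ≡⟨ mass-start≡1 k ⟩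
      1ℚ                        ∎)
      where open ≡-Reasoning

  missWeight-nonNeg : ∀ T a b c d → 0ℚ ≤ missWeight δ T a b c d
  missWeight-nonNeg T a b c d with hits T a b c d
  ... | true  = ≤-refl
  ... | false = *-nonNeg (*-nonNeg (*-nonNeg (δ-nonNeg start a) (δ-nonNeg a b))
                                   (δ-nonNeg b c)) (δ-nonNeg c d)

  Triangle⇒PrMiss-pos : ∀ x y z → E x y ≡ true → E y z ≡ true → E z x ≡ true →
    0ℚ < PrMiss δ (Target x)
  Triangle⇒PrMiss-pos x y z exy eyz ezx =
    Σ⁴-pos {f = missWeight δ (Target x)} v₁ v₂ v₃ v₄ (missWeight-nonNeg (Target x))
      (subst (0ℚ <_) (sym (missWeight≡pathWeight δ (Target x) v₁ v₂ v₃ v₄ (closedPath-misses x y z)))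
             weight>0)
    where
    v₁ v₂ v₃ v₄ : PV n
    v₁ = cp zero x
    v₂ = cp (suc zero) y
    v₃ = cp (suc (suc zero)) z
    v₄ = cp (suc (suc (suc zero))) x
    weight>0 : 0ℚ < pathWeight δ v₁ v₂ v₃ v₄
    weight>0 = *-pos (*-pos (*-pos (support-pos _ _ refl) (support-pos _ _ exy))
                            (support-pos _ _ eyz)) (support-pos _ _ ezx)

  ¬Triangle⇒PrMiss≡0 : ¬ Triangle E → ∀ k → PrMiss δ (Target k) ≡ 0ℚ
  ¬Triangle⇒PrMiss≡0 ¬t k = Σ⁴-zero missWeight≡0
    where
    missWeight≡0 : ∀ a b c d → missWeight δ (Target k) a b c d ≡ 0ℚ
    missWeight≡0 a b c d with hits (Target k) a b c d in miss
    ... | true  = refl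
    ... | false with pathWeight δ a b c d ≟ 0ℚ
    ...   | yes w≡0 = w≡0
    ...   | no  w≢0 =
      let eₛ , e₁ , e₂ , e₃ = pathWeight≢0⇒edgePath w≢0
      in contradiction (missed-edgePath⇒Triangle E k a b c d eₛ e₁ e₂ e₃ miss) ¬t

mainTheorem10 : (n : ℕ) (E : Graph n) →
    (∀ i → E i i ≡ false) →
    (∀ i → ∃ λ l → E i l ≡ true) →
    (δ : PV n → PV n → ℚ) → IsTransition E δ →
    Triangle E ⇔ (¬ AlmostSureCoverage E δ)
mainTheorem10 n E _ out δ tr = mk⇔ Triangle⇒¬coverage ¬coverage⇒Triangle
  where
  Triangle⇒¬coverage : Triangle E → ¬ AlmostSureCoverage E δ
  Triangle⇒¬coverage (x , y , z , exy , eyz , ezx) coverage =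
    <⇒≢ (Triangle⇒PrMiss-pos tr x y z exy eyz ezx)
        (sym (Equivalence.to (PrReach≡1⇔PrMiss≡0 tr out x (Target x)) (coverage x)))

  ¬coverage⇒Triangle : ¬ AlmostSureCoverage E δ → Triangle E
  ¬coverage⇒Triangle ¬coverage = decidable-stable (Triangle? E) λ ¬t → ¬coverage λ k →
    Equivalence.from (PrReach≡1⇔PrMiss≡0 tr out k (Target k)) (¬Triangle⇒PrMiss≡0 tr ¬t k)
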